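{- For every integer $n \geq 1$, the number of skew-indecomposable permutations of length $n$ that avoid the pattern $123$ equals the Catalan number $c_{n-1} = \frac{1}{n}\binom{2(n-1)}{n-1}$.
   Context: A permutation $\sigma$ of length $k$ is contained as a pattern in a permutation $\pi = \pi_1\cdots\pi_n$ if some subsequence $\pi_{i_1}\cdots\pi_{i_k}$ ($i_1<\dots<i_k$) has the same relative order as $\sigma$; otherwise $\pi$ avoids $\sigma$. For permutations $\pi$ of length $n$ and $\sigma$ of length $k$, the skew sum $\pi \ominus \sigma$ is the permutation of length $n+k$ with $(\pi\ominus\sigma)_i = \pi_i + k$ for $i \le n$ and $(\pi\ominus\sigma)_i = \sigma_{i-n}$ for $i>n$. A permutation is skew-decomposable if it equals $\pi\ominus\sigma$ for some nonempty $\pi,\sigma$, and skew-indecomposable otherwise. -}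

module Defs where

open import Data.Nat using (ℕ; _+_; _*_; _/_)
open import Data.Nat.Combinatorics using (_C_)
open import Data.Fin using (Fin; zero; suc; _<_; _↑ˡ_; _↑ʳ_; cast)
open import Data.Nat.Properties using (+-comm)
open import Data.Vec using (Vec; []; _∷_; lookup; _++_; map)
open import Data.Product using (Σ; ∃; _×_)
open import Data.List using (List; length)
open import Data.List.Membership.Propositional using (_∈_)
open import Data.List.Relation.Unary.Unique.Propositional using (Unique)
open import Relation.Binary.PropositionalEquality using (_≡_; refl)
open import Relation.Nullary using (¬_)

-- A permutation of length n in one-line notation: the word π₁⋯πₙ with values
-- in {0,…,n-1} (i.e. 1…n shifted down by one), all values distinct.
IsPerm : ∀ {n} → Vec (Fin n) n → Set
IsPerm {n} π = ∀ (i j : Fin n) → lookup π i ≡ lookup π j → i ≡ j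

Contains : ∀ {n k} → Vec (Fin n) n → Vec (Fin k) k → Set
Contains {n} {k} π σ =
  Σ (Fin k → Fin n) λ ι →
    (∀ a b → a < b → ι a < ι b) ×
    (∀ a b → (lookup σ a < lookup σ b) → (lookup π (ι a) < lookup π (ι b))) ×
    (∀ a b → (lookup π (ι a) < lookup π (ι b)) → (lookup σ a < lookup σ b))

Avoids : ∀ {n k} → Vec (Fin n) n → Vec (Fin k) k → Set
Avoids π σ = ¬ Contains π σ

p123 : Vec (Fin 3) 3
p123 = zero ∷ suc zero ∷ suc (suc zero) ∷ []

-- skew sum: (π ⊖ σ)_i = π_i + k for i ≤ n, and σ_{i-n} for i > n
_⊖_ : ∀ {n k} → Vec (Fin n) n → Vec (Fin k) k → Vec (Fin (n + k)) (n + k)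
_⊖_ {n} {k} π σ = map (λ x → cast (+-comm k n) (k ↑ʳ x)) π ++ map (λ y → cast (+-comm k n) (y ↑ˡ n)) σ

PermEq : ∀ {m n} → Vec (Fin m) m → Vec (Fin n) n → m ≡ n → Set
PermEq x y refl = x ≡ y

SkewDecomposable : ∀ {n} → Vec (Fin n) n → Set
SkewDecomposable {n} π =
  Σ ℕ λ a → Σ ℕ λ b → Σ (ℕ.suc a + ℕ.suc b ≡ n) λ eq →
    Σ (Vec (Fin (ℕ.suc a)) (ℕ.suc a)) λ α → Σ (Vec (Fin (ℕ.suc b)) (ℕ.suc b)) λ β →
      IsPerm α × IsPerm β × PermEq (α ⊖ β) π eq

SkewIndecomposable : ∀ {n} → Vec (Fin n) n → Set
SkewIndecomposable π = ¬ SkewDecomposable π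

-- "the number of x satisfying P is c": there is a duplicate-free list whose
-- members are exactly the x satisfying P, and it has length c.
HasCount : {A : Set} → (A → Set) → ℕ → Set
HasCount {A} P c =
  Σ (List A) λ L → Unique L × (∀ x → (x ∈ L → P x) × (P x → x ∈ L)) × (length L ≡ c)

catalan : ℕ → ℕ
catalan m = ((2 * m) C m) / ℕ.suc m

-- Every skew-indecomposable 123-avoider τ of length n + 3 arises from exactly one such σ of
-- length n + 2: either the maximum of τ sits in second position and σ is τ without it, or σ
-- is τ without its first entry v, and then σ₀ < v < n + 2.  In the second case a skew split
-- of σ would force v ≤ σ₀, and avoiding 123 would then make σ₀ the maximum of σ, putting the
-- maximum of τ in second position.  Conversely both constructions preserve the property; a
-- prepended v > σ₀ starts no 123 because every ascent of σ starts at a value ≤ σ₀.  Labelling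
-- σ by the number n + 1 − σ₀ of values above σ₀, a node labelled c has children labelled
-- c + 1, c, …, 1, so the number of nodes at depth n below the root 01 is the ballot number
-- C(2n+1, n) − C(2n+1, n−1) = c_{n+1}.
module Submission where

open import Defs
open import Data.Nat using (ℕ; zero; suc; pred; >-nonZero; _+_; _*_; _∸_; _/_; _≤_; _<_; _≤?_; _<?_; z≤n; s≤s; z<s; s<s)
import Data.Nat as ℕ
open import Data.Nat.Properties
  using (≤-refl; ≤-reflexive; ≤-trans; ≤-antisym; ≤-pred; <-trans; ≤-<-trans; <-≤-trans; <-irrefl; <-asym; <-cmp;
         <⇒≤; <⇒≱; ≮⇒≥; ≰⇒>; ≤∧≢⇒<; n≮0; n≤1+n; m<n⇒m<1+n; suc-injective; suc-pred;
         +-comm; +-assoc; +-suc; +-identityʳ; +-cancelˡ-≡; +-cancelʳ-<; *-comm; *-identityˡ; *-identityʳ; *-zeroʳ;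
         *-distribˡ-+; *-distribʳ-+; m≤m+n; m<m+n; m+n∸m≡n; m∸n+n≡m; m+[n∸m]≡n; m∸n≤m; m∸[m∸n]≡n; +-∸-assoc;
         m<n⇒0<n∸m; ∸-monoʳ-<; ∸-cancelˡ-≡)
open import Data.Nat.Combinatorics using (_C_; nCk≡nC[n∸k]; nCn≡1; nC1≡n; k>n⇒nCk≡0; nCk+nC[k+1]≡[n+1]C[k+1])
open import Data.Nat.DivMod using (m*n/n≡m)
open import Data.Nat.ListAction using (sum)
open import Data.Nat.ListAction.Properties using (sum-++)
open import Data.Nat.Tactic.RingSolver using (solve-∀)
open import Data.Fin using (Fin; zero; suc; toℕ; fromℕ; fromℕ<; punchIn; punchOut; _↑ˡ_; _↑ʳ_; cast; reduce≥)
open import Data.Fin.Patterns using (0F; 1F; 2F)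
open import Data.Fin.Properties
  using (_≟_; injective⇒existsPivot; punchIn-injective; punchInᵢ≢i; punchIn-punchOut; toℕ-injective; toℕ<n;
         toℕ-fromℕ; toℕ-fromℕ<; toℕ-cast; toℕ-↑ˡ; toℕ-↑ʳ; ↑ˡ-injective; ↑ʳ-injective)
open import Data.Vec as Vec using (Vec; []; _∷_; lookup; tabulate; insertAt)
open import Data.Vec.Properties
  using (insertAt-lookup; insertAt-punchIn; lookup-map; lookup∘tabulate; tabulate∘lookup; tabulate-cong; lookup-++-<; lookup-++-≥)
open import Data.List using (List; []; _∷_; map; concatMap; applyDownFrom; length)
open import Data.List.Properties using (map-++; map-applyDownFrom; map-cong)
open import Data.List.Membership.Propositional using (_∈_; find; lose)
open import Data.List.Membership.Propositional.Properties using (∈-concatMap⁺; ∈-concatMap⁻; ∈-applyDownFrom⁺; ∈-applyDownFrom⁻)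
open import Data.List.Relation.Unary.Any using (here; there)
import Data.List.Relation.Unary.All as All
open import Data.List.Relation.Unary.AllPairs using ([]; _∷_)
open import Data.List.Relation.Unary.Unique.Propositional using (Unique)
open import Data.List.Relation.Unary.Unique.Propositional.Properties using (++⁺; applyDownFrom⁺₁)
open import Data.Product using (∃; Σ-syntax; _×_; _,_; proj₁; proj₂)
open import Data.Sum using (_⊎_; inj₁; inj₂)
open import Data.Empty using (⊥; ⊥-elim)
open import Function using (_∘_; case_of_)
open import Relation.Nullary using (¬_; yes; no; contradiction)
open import Relation.Binary.Definitions using (tri<; tri≈; tri>)
open import Relation.Binary.PropositionalEquality
  using (_≡_; _≢_; refl; sym; trans; cong; cong₂; subst; subst₂; module ≡-Reasoning)

open ≡-Reasoning

-- Ballot numbers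

nC0≡1 : ∀ n → n C 0 ≡ 1
nC0≡1 n = trans (nCk≡nC[n∸k] {0} {n} z≤n) (nCn≡1 n)

[a+b]Ca≡[a+b]Cb : ∀ a b → (a + b) C a ≡ (a + b) C b
[a+b]Ca≡[a+b]Cb a b = trans (nCk≡nC[n∸k] (m≤m+n a b)) (cong ((a + b) C_) (m+n∸m≡n a b))

[k+1]*[n+1]C[k+1]≡[n+1]*nCk : ∀ n k → suc k * (suc n C suc k) ≡ suc n * (n C k)
[k+1]*[n+1]C[k+1]≡[n+1]*nCk zero zero = refl
[k+1]*[n+1]C[k+1]≡[n+1]*nCk zero (suc k) = begin
  suc (suc k) * (1 C suc (suc k)) ≡⟨ cong (suc (suc k) *_) (k>n⇒nCk≡0 {1} {suc (suc k)} (s≤s (s≤s z≤n))) ⟩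
  suc (suc k) * 0                 ≡⟨ *-zeroʳ (suc (suc k)) ⟩
  0                               ≡⟨ sym (+-identityʳ _) ⟩
  1 * 0                           ≡⟨ cong (1 *_) (sym (k>n⇒nCk≡0 {0} {suc k} (s≤s z≤n))) ⟩
  1 * (0 C suc k)                 ∎
[k+1]*[n+1]C[k+1]≡[n+1]*nCk (suc n) zero = begin
  1 * (suc (suc n) C 1)      ≡⟨ *-identityˡ _ ⟩
  suc (suc n) C 1            ≡⟨ nC1≡n (suc (suc n)) ⟩
  suc (suc n)                ≡⟨ sym (*-identityʳ _) ⟩
  suc (suc n) * 1            ≡⟨ cong (suc (suc n) *_) (sym (nC0≡1 (suc n))) ⟩
  suc (suc n) * (suc n C 0)  ∎
[k+1]*[n+1]C[k+1]≡[n+1]*nCk (suc n) (suc k) = begin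
  suc (suc k) * (suc (suc n) C suc (suc k))
    ≡⟨ cong (suc (suc k) *_) (sym (nCk+nC[k+1]≡[n+1]C[k+1] (suc n) (suc k))) ⟩
  suc (suc k) * (suc n C suc k + suc n C suc (suc k))
    ≡⟨ *-distribˡ-+ (suc (suc k)) (suc n C suc k) _ ⟩
  (suc n C suc k + suc k * (suc n C suc k)) + suc (suc k) * (suc n C suc (suc k))
    ≡⟨ cong₂ (λ x y → (suc n C suc k + x) + y) ([k+1]*[n+1]C[k+1]≡[n+1]*nCk n k) ([k+1]*[n+1]C[k+1]≡[n+1]*nCk n (suc k)) ⟩
  (suc n C suc k + suc n * (n C k)) + suc n * (n C suc k)
    ≡⟨ regroup (suc n C suc k) (suc n) (n C k) (n C suc k) ⟩
  suc n C suc k + suc n * (n C k + n C suc k)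
    ≡⟨ cong (λ x → suc n C suc k + suc n * x) (nCk+nC[k+1]≡[n+1]C[k+1] n k) ⟩
  suc (suc n) * (suc n C suc k) ∎
  where
  regroup : ∀ a b x y → (a + b * x) + b * y ≡ a + b * (x + y)
  regroup = solve-∀

infixl 6.5 _C⁻_

_C⁻_ : ℕ → ℕ → ℕ
n C⁻ zero  = 0
n C⁻ suc k = n C k

C⁻-pascal : ∀ n k → n C⁻ k + n C k ≡ suc n C k
C⁻-pascal n zero    = trans (nC0≡1 n) (sym (nC0≡1 (suc n)))
C⁻-pascal n (suc k) = nCk+nC[k+1]≡[n+1]C[k+1] n k

infixl 6 _*2+_

_*2+_ : ℕ → ℕ → ℕ
zero  *2+ c = c
suc j *2+ c = suc (suc (j *2+ c))

*2+-suc : ∀ j c → j *2+ suc c ≡ suc (j *2+ c)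
*2+-suc zero    c = refl
*2+-suc (suc j) c = cong (2 +_) (*2+-suc j c)

*2+1≡j+[1+j] : ∀ j → j *2+ 1 ≡ j + suc j
*2+1≡j+[1+j] zero    = refl
*2+1≡j+[1+j] (suc j) = cong suc (trans (cong suc (*2+1≡j+[1+j] j)) (sym (+-suc j (suc j))))

-- ballot j c counts the nodes at depth j below a node labelled c in the
-- generating tree (c) ↦ (1) (2) ⋯ (c + 1); see ballot-suc.
ballot : ℕ → ℕ → ℕ
ballot zero    c       = 1
ballot (suc j) zero    = ballot j 1
ballot (suc j) (suc c) = ballot (suc j) c + ballot j (suc (suc c))

ballot-suc : ∀ j c → ballot (suc j) c ≡ ballot j (suc c) + sum (applyDownFrom (ballot j ∘ suc) c)
ballot-suc j zero    = sym (+-identityʳ (ballot j 1))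
ballot-suc j (suc c) = trans (cong (_+ ballot j (2 + c)) (ballot-suc j c))
                             (+-comm (ballot j (suc c) + _) (ballot j (2 + c)))

ballot-C : ∀ j c → ballot j c + (j *2+ c) C⁻ j ≡ (j *2+ c) C j
ballot-C zero    c       = sym (nC0≡1 c)
ballot-C (suc j) zero    =
  subst (λ n → ballot j 1 + suc n C j ≡ suc n C suc j) (*2+-suc j 0) (begin
    ballot j 1 + suc S C j              ≡⟨ cong (ballot j 1 +_) (sym (C⁻-pascal S j)) ⟩
    ballot j 1 + (S C⁻ j + S C j)       ≡⟨ sym (+-assoc (ballot j 1) _ _) ⟩
    (ballot j 1 + S C⁻ j) + S C j       ≡⟨ cong (_+ S C j) (ballot-C j 1) ⟩
    S C j + S C j                       ≡⟨ cong (S C j +_) middle ⟩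
    S C j + S C suc j                   ≡⟨ nCk+nC[k+1]≡[n+1]C[k+1] S j ⟩
    suc S C suc j                       ∎)
  where
  S : ℕ
  S = j *2+ 1
  middle : S C j ≡ S C suc j
  middle = subst (λ n → n C j ≡ n C suc j) (sym (*2+1≡j+[1+j] j)) ([a+b]Ca≡[a+b]Cb j (suc j))
ballot-C (suc j) (suc c) =
  subst (λ n → ballot (suc j) (suc c) + n C⁻ suc j ≡ n C suc j) (sym (*2+-suc (suc j) c)) (begin
    (ballot (suc j) c + ballot j (2 + c)) + suc T C j
      ≡⟨ cong (ballot (suc j) c + ballot j (2 + c) +_) (sym (C⁻-pascal T j)) ⟩
    (ballot (suc j) c + ballot j (2 + c)) + (T C⁻ j + T C j)
      ≡⟨ interchange (ballot (suc j) c) (ballot j (2 + c)) (T C⁻ j) (T C j) ⟩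
    (ballot (suc j) c + T C j) + (ballot j (2 + c) + T C⁻ j)
      ≡⟨ cong₂ _+_ (ballot-C (suc j) c) deeper ⟩
    T C suc j + T C j
      ≡⟨ +-comm (T C suc j) (T C j) ⟩
    T C j + T C suc j
      ≡⟨ nCk+nC[k+1]≡[n+1]C[k+1] T j ⟩
    suc T C suc j
      ∎)
  where
  T : ℕ
  T = suc j *2+ c
  interchange : ∀ a b x y → (a + b) + (x + y) ≡ (a + y) + (b + x)
  interchange = solve-∀
  deeper : ballot j (2 + c) + T C⁻ j ≡ T C j
  deeper = subst (λ n → ballot j (2 + c) + n C⁻ j ≡ n C j)
                 (trans (*2+-suc j (suc c)) (cong suc (*2+-suc j c))) (ballot-C j (2 + c))

C⁻-central : ∀ n → ((n + suc n) C⁻ n) * suc (suc n) ≡ ((n + suc n) C n) * n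
C⁻-central zero    = refl
C⁻-central (suc i) = begin
  (S C i) * (3 + i)    ≡⟨ *-comm (S C i) (3 + i) ⟩
  (3 + i) * (S C i)    ≡⟨ cong (λ n → (3 + i) * (n C i)) S≡i+[3+i] ⟩
  (3 + i) * (S′ C i)   ≡⟨ cong ((3 + i) *_) ([a+b]Ca≡[a+b]Cb i (3 + i)) ⟩
  (3 + i) * (S′ C (3 + i)) ≡⟨ cong (λ n → (3 + i) * (n C (3 + i))) (sym S≡i+[3+i]) ⟩
  (3 + i) * (S C (3 + i))  ≡⟨ [k+1]*[n+1]C[k+1]≡[n+1]*nCk M (2 + i) ⟩
  S * (M C (2 + i))    ≡⟨ cong (S *_) (sym ([a+b]Ca≡[a+b]Cb i (2 + i))) ⟩
  S * (M C i)          ≡⟨ sym ([k+1]*[n+1]C[k+1]≡[n+1]*nCk M i) ⟩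
  suc i * (S C suc i)  ≡⟨ *-comm (suc i) (S C suc i) ⟩
  (S C suc i) * suc i  ∎
  where
  M S S′ : ℕ
  M = i + suc (suc i)
  S = suc M
  S′ = i + (3 + i)
  S≡i+[3+i] : S ≡ S′
  S≡i+[3+i] = sym (+-suc i (2 + i))

catalan≡ballot : ∀ n → catalan (suc n) ≡ ballot n 1
catalan≡ballot n = begin
  ((2 * suc n) C suc n) / suc (suc n) ≡⟨ cong (λ m → (m C suc n) / suc (suc n)) (2*[1+n]≡1+S n) ⟩
  (suc S C suc n) / suc (suc n)     ≡⟨ cong (_/ suc (suc n)) (sym (nCk+nC[k+1]≡[n+1]C[k+1] S n)) ⟩
  (X + S C suc n) / suc (suc n)     ≡⟨ cong (λ m → (X + m) / suc (suc n)) (sym ([a+b]Ca≡[a+b]Cb n (suc n))) ⟩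
  (X + X) / suc (suc n)             ≡⟨ cong (_/ suc (suc n)) (sym ballot*[2+n]≡X+X) ⟩
  (ballot n 1 * suc (suc n)) / suc (suc n) ≡⟨ m*n/n≡m (ballot n 1) (suc (suc n)) ⟩
  ballot n 1                        ∎
  where
  S X : ℕ
  S = n + suc n
  X = S C n
  2*[1+n]≡1+S : ∀ n → 2 * suc n ≡ suc (n + suc n)
  2*[1+n]≡1+S = solve-∀
  ballot+C⁻ : ballot n 1 + S C⁻ n ≡ X
  ballot+C⁻ = subst (λ m → ballot n 1 + m C⁻ n ≡ m C n) (*2+1≡j+[1+j] n) (ballot-C n 1)
  ballot*[2+n]≡X+X : ballot n 1 * suc (suc n) ≡ X + X
  ballot*[2+n]≡X+X = +-cancelˡ-≡ (X * n) _ _ (begin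
    X * n + ballot n 1 * suc (suc n)              ≡⟨ +-comm (X * n) _ ⟩
    ballot n 1 * suc (suc n) + X * n              ≡⟨ cong (ballot n 1 * suc (suc n) +_) (sym (C⁻-central n)) ⟩
    ballot n 1 * suc (suc n) + (S C⁻ n) * suc (suc n) ≡⟨ sym (*-distribʳ-+ (suc (suc n)) (ballot n 1) _) ⟩
    (ballot n 1 + S C⁻ n) * suc (suc n)           ≡⟨ cong (_* suc (suc n)) ballot+C⁻ ⟩
    X * suc (suc n)                               ≡⟨ expand X n ⟩
    X * n + (X + X)                               ∎)
    where
    expand : ∀ x n → x * suc (suc n) ≡ x * n + (x + x)
    expand = solve-∀

-- Pattern avoidance and skew splits

lookup-ext : ∀ {A : Set} {n} {u w : Vec A n} → (∀ i → lookup u i ≡ lookup w i) → u ≡ w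
lookup-ext {u = u} {w} h = trans (sym (tabulate∘lookup u)) (trans (tabulate-cong h) (tabulate∘lookup w))

infixl 9 _!_

_!_ : ∀ {n} → Vec (Fin n) n → Fin n → ℕ
π ! i = toℕ (lookup π i)

Ascent : ∀ {n} → Vec (Fin n) n → Fin n → Fin n → Set
Ascent π i j = toℕ i < toℕ j × π ! i < π ! j

Avoids123 : ∀ {n} → Vec (Fin n) n → Set
Avoids123 π = ∀ i j k → Ascent π i j → Ascent π j k → ⊥

-- π = α ⊖ β with α of length j.
SkewSplitAt : ∀ {n} → Vec (Fin n) n → ℕ → Set
SkewSplitAt {n} π j = (∀ i → toℕ i < j → n ∸ j ≤ π ! i) × (∀ i → j ≤ toℕ i → π ! i < n ∸ j)

HasSkewSplit : ∀ {n} → Vec (Fin n) n → Set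
HasSkewSplit {n} π = Σ[ j ∈ Fin n ] 0 < toℕ j × SkewSplitAt π (toℕ j)

Indec123 : ∀ {n} → Vec (Fin n) n → Set
Indec123 π = IsPerm π × Avoids123 π × ¬ HasSkewSplit π

lookup-p123 : ∀ a → lookup p123 a ≡ a
lookup-p123 0F = refl
lookup-p123 1F = refl
lookup-p123 2F = refl

avoids-p123⇒avoids123 : ∀ {n} {π : Vec (Fin n) n} → Avoids π p123 → Avoids123 π
avoids-p123⇒avoids123 {n} {π} avoids i j k (i<j , πi<πj) (j<k , πj<πk) = avoids (ι , ι-increasing , ι-preserves , ι-reflects)
  where
  ι : Fin 3 → Fin n
  ι 0F = i
  ι 1F = j
  ι 2F = k
  ι-increasing : ∀ a b → toℕ a < toℕ b → toℕ (ι a) < toℕ (ι b)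
  ι-increasing 0F 1F _ = i<j
  ι-increasing 0F 2F _ = <-trans i<j j<k
  ι-increasing 1F 2F _ = j<k
  ι-increasing 1F 1F (s<s ())
  ι-increasing 2F 2F (s<s (s<s ()))
  ι-increasing 2F 1F (s<s ())
  ι-values : ∀ a b → toℕ a < toℕ b → π ! ι a < π ! ι b
  ι-values 0F 1F _ = πi<πj
  ι-values 0F 2F _ = <-trans πi<πj πj<πk
  ι-values 1F 2F _ = πj<πk
  ι-values 1F 1F (s<s ())
  ι-values 2F 2F (s<s (s<s ()))
  ι-values 2F 1F (s<s ())
  ι-preserves : ∀ a b → toℕ (lookup p123 a) < toℕ (lookup p123 b) → π ! ι a < π ! ι b
  ι-preserves a b = ι-values a b ∘ subst₂ (λ x y → toℕ x < toℕ y) (lookup-p123 a) (lookup-p123 b)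
  ι-reflects : ∀ a b → π ! ι a < π ! ι b → toℕ (lookup p123 a) < toℕ (lookup p123 b)
  ι-reflects a b πa<πb with <-cmp (toℕ a) (toℕ b)
  ... | tri< a<b _ _ = subst₂ (λ x y → toℕ x < toℕ y) (sym (lookup-p123 a)) (sym (lookup-p123 b)) a<b
  ... | tri≈ _ a≡b _ = contradiction (subst (λ c → π ! ι a < π ! ι c) (sym (toℕ-injective a≡b)) πa<πb) (<-irrefl refl)
  ... | tri> _ _ b<a = contradiction πa<πb (<-asym (ι-values b a b<a))

avoids123⇒avoids-p123 : ∀ {n} {π : Vec (Fin n) n} → Avoids123 π → Avoids π p123
avoids123⇒avoids-p123 avoids123 (ι , ι-increasing , ι-preserves , _) =
  avoids123 (ι 0F) (ι 1F) (ι 2F) (ι-increasing 0F 1F z<s , ι-preserves 0F 1F z<s)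
                                 (ι-increasing 1F 2F (s<s z<s) , ι-preserves 1F 2F (s<s z<s))

toℕ-reduce≥ : ∀ {m n} (i : Fin (m + n)) .(m≤i : m ≤ toℕ i) → toℕ (reduce≥ {m} i m≤i) ≡ toℕ i ∸ m
toℕ-reduce≥ {zero}  i       _   = refl
toℕ-reduce≥ {suc m} (suc i) m≤i = toℕ-reduce≥ {m} i (≤-pred m≤i)

module _ {a b : ℕ} (α : Vec (Fin (suc a)) (suc a)) (β : Vec (Fin (suc b)) (suc b)) where

  private
    up : Fin (suc a) → Fin (suc a + suc b)
    up x = cast (+-comm (suc b) (suc a)) (suc b ↑ʳ x)
    down : Fin (suc b) → Fin (suc a + suc b)
    down y = cast (+-comm (suc b) (suc a)) (y ↑ˡ suc a)

  ⊖-!-< : ∀ i (i<A : toℕ i < suc a) → (α ⊖ β) ! i ≡ suc b + α ! fromℕ< i<A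
  ⊖-!-< i i<A = trans (cong toℕ (trans (lookup-++-< (Vec.map up α) (Vec.map down β) i i<A) (lookup-map (fromℕ< i<A) up α)))
                      (trans (toℕ-cast (+-comm (suc b) (suc a)) _) (toℕ-↑ʳ (suc b) _))

  ⊖-!-≥ : ∀ i (A≤i : suc a ≤ toℕ i) → (α ⊖ β) ! i ≡ β ! reduce≥ i A≤i
  ⊖-!-≥ i A≤i = trans (cong toℕ (trans (lookup-++-≥ (Vec.map up α) (Vec.map down β) i A≤i) (lookup-map (reduce≥ i A≤i) down β)))
                      (trans (toℕ-cast (+-comm (suc b) (suc a)) _) (toℕ-↑ˡ _ (suc a)))

  ⊖-skewSplitAt : SkewSplitAt (α ⊖ β) (suc a)
  ⊖-skewSplitAt rewrite m+n∸m≡n (suc a) (suc b) =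
      (λ i i<A → subst (suc b ≤_) (sym (⊖-!-< i i<A)) (m≤m+n (suc b) _))
    , (λ i A≤i → subst (_< suc b) (sym (⊖-!-≥ i A≤i)) (toℕ<n _))

skewDecomposable⇒hasSkewSplit : ∀ {n} {π : Vec (Fin n) n} → SkewDecomposable π → HasSkewSplit π
skewDecomposable⇒hasSkewSplit (a , b , refl , α , β , _ , _ , refl) =
  fromℕ< A<A+B , subst (0 <_) (sym (toℕ-fromℕ< A<A+B)) z<s ,
  subst (SkewSplitAt (α ⊖ β)) (sym (toℕ-fromℕ< A<A+B)) (⊖-skewSplitAt α β)
  where
  A<A+B : suc a < suc a + suc b
  A<A+B = m<m+n (suc a) z<s

module Halves {a b : ℕ} (π : Vec (Fin (suc a + suc b)) (suc a + suc b))
              (π-perm : IsPerm π) (split : SkewSplitAt π (suc a)) where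

  A B : ℕ
  A = suc a
  B = suc b

  high : ∀ i → toℕ i < A → B ≤ π ! i
  high i i<A = subst (_≤ π ! i) (m+n∸m≡n A B) (proj₁ split i i<A)

  low : ∀ i → A ≤ toℕ i → π ! i < B
  low i A≤i = subst (π ! i <_) (m+n∸m≡n A B) (proj₂ split i A≤i)

  high-< : ∀ (i : Fin A) → toℕ (i ↑ˡ B) < A
  high-< i = subst (_< A) (sym (toℕ-↑ˡ i B)) (toℕ<n i)

  low-≥ : ∀ (i : Fin B) → A ≤ toℕ (A ↑ʳ i)
  low-≥ i = subst (A ≤_) (sym (toℕ-↑ʳ A i)) (m≤m+n A (toℕ i))

  high-! : ∀ i → π ! (i ↑ˡ B) ∸ B + B ≡ π ! (i ↑ˡ B)
  high-! i = m∸n+n≡m (high _ (high-< i))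

  shifted< : ∀ i → π ! (i ↑ˡ B) ∸ B < A
  shifted< i = +-cancelʳ-< B _ A (subst (_< A + B) (sym (high-! i)) (toℕ<n (lookup π (i ↑ˡ B))))

  leftEntry : Fin A → Fin A
  leftEntry i = fromℕ< (shifted< i)

  rightEntry : Fin B → Fin B
  rightEntry i = fromℕ< (low (A ↑ʳ i) (low-≥ i))

  left : Vec (Fin A) A
  left = tabulate leftEntry

  right : Vec (Fin B) B
  right = tabulate rightEntry

  left-! : ∀ i → left ! i ≡ π ! (i ↑ˡ B) ∸ B
  left-! i = trans (cong toℕ (lookup∘tabulate leftEntry i)) (toℕ-fromℕ< (shifted< i))

  right-! : ∀ i → right ! i ≡ π ! (A ↑ʳ i)
  right-! i = trans (cong toℕ (lookup∘tabulate rightEntry i)) (toℕ-fromℕ< (low (A ↑ʳ i) (low-≥ i)))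

  left-isPerm : IsPerm left
  left-isPerm i j eq = ↑ˡ-injective B i j (π-perm _ _ (toℕ-injective (begin
    π ! (i ↑ˡ B)               ≡⟨ sym (high-! i) ⟩
    π ! (i ↑ˡ B) ∸ B + B       ≡⟨ cong (_+ B) (trans (sym (left-! i)) (trans (cong toℕ eq) (left-! j))) ⟩
    π ! (j ↑ˡ B) ∸ B + B       ≡⟨ high-! j ⟩
    π ! (j ↑ˡ B)               ∎)))

  right-isPerm : IsPerm right
  right-isPerm i j eq =
    ↑ʳ-injective A i j (π-perm _ _ (toℕ-injective (trans (sym (right-! i)) (trans (cong toℕ eq) (right-! j)))))

  halves : left ⊖ right ≡ π
  halves = lookup-ext λ i → toℕ-injective (same i)
    where
    same : ∀ i → (left ⊖ right) ! i ≡ π ! i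
    same i with toℕ i <? A
    ... | yes i<A = begin
      (left ⊖ right) ! i              ≡⟨ ⊖-!-< left right i i<A ⟩
      B + left ! fromℕ< i<A           ≡⟨ cong (B +_) (left-! (fromℕ< i<A)) ⟩
      B + (π ! (fromℕ< i<A ↑ˡ B) ∸ B) ≡⟨ cong (λ k → B + (π ! k ∸ B)) position ⟩
      B + (π ! i ∸ B)                 ≡⟨ m+[n∸m]≡n (high i i<A) ⟩
      π ! i                           ∎
      where
      position : fromℕ< i<A ↑ˡ B ≡ i
      position = toℕ-injective (trans (toℕ-↑ˡ _ B) (toℕ-fromℕ< i<A))
    ... | no i≮A = trans (⊖-!-≥ left right i A≤i) (trans (right-! _) (cong (π !_) position))
      where
      A≤i : A ≤ toℕ i
      A≤i = ≮⇒≥ i≮A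
      position : A ↑ʳ reduce≥ i A≤i ≡ i
      position = toℕ-injective (trans (toℕ-↑ʳ A _) (trans (cong (A +_) (toℕ-reduce≥ {A} i A≤i)) (m+[n∸m]≡n A≤i)))

hasSkewSplit⇒skewDecomposable : ∀ {n} {π : Vec (Fin n) n} → IsPerm π → HasSkewSplit π → SkewDecomposable π
hasSkewSplit⇒skewDecomposable {n} {π} π-perm (j , 0<j , split) =
  decompose (pred (toℕ j)) (pred (n ∸ toℕ j)) lengths π π-perm (subst (SkewSplitAt π) (sym A≡j) split)
  where
  A≡j : suc (pred (toℕ j)) ≡ toℕ j
  A≡j = suc-pred (toℕ j) {{>-nonZero 0<j}}
  lengths : suc (pred (toℕ j)) + suc (pred (n ∸ toℕ j)) ≡ n
  lengths = trans (cong₂ _+_ A≡j (suc-pred (n ∸ toℕ j) {{>-nonZero (m<n⇒0<n∸m (toℕ<n j))}}))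
                  (m+[n∸m]≡n (<⇒≤ (toℕ<n j)))
  decompose : ∀ a b (eq : suc a + suc b ≡ n) (π : Vec (Fin n) n) → IsPerm π → SkewSplitAt π (suc a) → SkewDecomposable π
  decompose a b refl π π-perm split = a , b , refl , left , right , left-isPerm , right-isPerm , halves
    where open Halves π π-perm split

indec123⇒skewIndecomposable-avoider : ∀ {n} {π : Vec (Fin n) n} →
                                      Indec123 π → IsPerm π × Avoids π p123 × SkewIndecomposable π
indec123⇒skewIndecomposable-avoider {π = π} (perm , avoids , indec) =
  perm , avoids123⇒avoids-p123 {π = π} avoids , indec ∘ skewDecomposable⇒hasSkewSplit

skewIndecomposable-avoider⇒indec123 : ∀ {n} {π : Vec (Fin n) n} →
                                      IsPerm π × Avoids π p123 × SkewIndecomposable π → Indec123 π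
skewIndecomposable-avoider⇒indec123 {π = π} (perm , avoids , indec) =
  perm , avoids-p123⇒avoids123 {π = π} avoids , indec ∘ hasSkewSplit⇒skewDecomposable perm

isPerm⇒attains-max : ∀ {n} (π : Vec (Fin (suc n)) (suc n)) → IsPerm π → ∃ λ i → π ! i ≡ n
isPerm⇒attains-max {n} π π-perm with injective⇒existsPivot (λ {i} {j} → π-perm i j) (fromℕ n)
... | i , _ , n≤πi = i , ≤-antisym (≤-pred (toℕ<n _)) (subst (_≤ π ! i) (toℕ-fromℕ n) n≤πi)

below-max : ∀ {n} (π : Vec (Fin (suc n)) (suc n)) → IsPerm π → ∀ {i j} → π ! j ≡ n → i ≢ j → π ! i < n
below-max π π-perm πj≡n i≢j = ≤∧≢⇒< (≤-pred (toℕ<n _)) λ πi≡n → i≢j (π-perm _ _ (toℕ-injective (trans πi≡n (sym πj≡n))))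

skewSplitAt-0 : ∀ {n} (π : Vec (Fin n) n) → SkewSplitAt π 0
skewSplitAt-0 π = (λ _ ()) , λ i _ → toℕ<n (lookup π i)

first-max⇒hasSkewSplit : ∀ {n} (π : Vec (Fin (suc (suc n))) (suc (suc n))) → IsPerm π → π ! 0F ≡ suc n → HasSkewSplit π
first-max⇒hasSkewSplit {n} π π-perm π0≡max = 1F , z<s , block , rest
  where
  block : ∀ i → toℕ i < 1 → suc n ≤ π ! i
  block 0F _ = ≤-reflexive (sym π0≡max)
  block (suc i) (s<s ())
  rest : ∀ i → 1 ≤ toℕ i → π ! i < suc n
  rest (suc i) _ = below-max π π-perm π0≡max λ ()

AscentsBelow : ∀ {n} → Vec (Fin n) n → ℕ → Set
AscentsBelow π t = ∀ i j → Ascent π i j → π ! i < t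

first<⇒ascentsBelow : ∀ {n} {π : Vec (Fin (suc n)) (suc n)} {t} → Avoids123 π → π ! 0F < t → AscentsBelow π t
first<⇒ascentsBelow avoids π0<t 0F j _ = π0<t
first<⇒ascentsBelow {π = π} avoids π0<t (suc i) j ij with π ! suc i ≤? π ! 0F
... | yes πi≤π0 = ≤-<-trans πi≤π0 π0<t
... | no  πi≰π0 = ⊥-elim (avoids 0F (suc i) j (z<s , ≰⇒> πi≰π0) ij)

ascentsBelow⇒first< : ∀ {n} {π : Vec (Fin (suc (suc n))) (suc (suc n))} {t} → Indec123 π → AscentsBelow π t → π ! 0F < t
ascentsBelow⇒first< {π = π} (π-perm , _ , π-indec) below with isPerm⇒attains-max π π-perm
... | 0F    , π0≡max = contradiction (first-max⇒hasSkewSplit π π-perm π0≡max) π-indec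
... | suc i , πi≡max = below 0F (suc i) (z<s , subst (_ <_) (sym πi≡max) (below-max π π-perm πi≡max λ ()))

unique-singleton : ∀ (σ : Vec (Fin 1) 1) → σ ≡ 0F ∷ []
unique-singleton (0F ∷ []) = refl

indec123-singleton : Indec123 (0F ∷ [])
indec123-singleton = (λ { 0F 0F _ → refl }) , (λ { 0F 0F _ (() , _) _ }) , λ { (0F , () , _) }

-- Inserting an entry

toℕ-punchIn-< : ∀ {n} (v : Fin (suc n)) {x : Fin n} → toℕ x < toℕ v → toℕ (punchIn v x) ≡ toℕ x
toℕ-punchIn-< (suc v) {zero}  _         = refl
toℕ-punchIn-< (suc v) {suc x} (s<s x<v) = cong suc (toℕ-punchIn-< v x<v)

toℕ-punchIn-≥ : ∀ {n} (v : Fin (suc n)) {x : Fin n} → toℕ v ≤ toℕ x → toℕ (punchIn v x) ≡ suc (toℕ x)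
toℕ-punchIn-≥ zero    _         = refl
toℕ-punchIn-≥ (suc v) {suc x} (s≤s v≤x) = cong suc (toℕ-punchIn-≥ v v≤x)

toℕ≤toℕ-punchIn : ∀ {n} (v : Fin (suc n)) (x : Fin n) → toℕ x ≤ toℕ (punchIn v x)
toℕ≤toℕ-punchIn v x with toℕ x <? toℕ v
... | yes x<v = ≤-reflexive (sym (toℕ-punchIn-< v x<v))
... | no x≮v  = ≤-trans (n≤1+n _) (≤-reflexive (sym (toℕ-punchIn-≥ v (≮⇒≥ x≮v))))

punchIn-mono-< : ∀ {n} (v : Fin (suc n)) {x y : Fin n} → toℕ x < toℕ y → toℕ (punchIn v x) < toℕ (punchIn v y)
punchIn-mono-< zero    x<y                         = s<s x<y
punchIn-mono-< (suc v) {zero}  {suc y} _           = z<s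
punchIn-mono-< (suc v) {suc x} {suc y} (s<s x<y)   = s<s (punchIn-mono-< v x<y)

punchIn-cancel-< : ∀ {n} (v : Fin (suc n)) {x y : Fin n} → toℕ (punchIn v x) < toℕ (punchIn v y) → toℕ x < toℕ y
punchIn-cancel-< zero    (s<s x<y)                  = x<y
punchIn-cancel-< (suc v) {zero}  {suc y} _          = z<s
punchIn-cancel-< (suc v) {suc x} {suc y} (s<s x<y)  = s<s (punchIn-cancel-< v x<y)

≡⊎punchIn : ∀ {n} (p i : Fin (suc n)) → p ≡ i ⊎ ∃ λ j → punchIn p j ≡ i
≡⊎punchIn p i with p ≟ i
... | yes p≡i = inj₁ p≡i
... | no  p≢i = inj₂ (punchOut p≢i , punchIn-punchOut p≢i)

insert : ∀ {n} → Vec (Fin n) n → Fin (suc n) → Fin (suc n) → Vec (Fin (suc n)) (suc n)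
insert π p v = insertAt (Vec.map (punchIn v) π) p v

module _ {n} (π : Vec (Fin n) n) (p v : Fin (suc n)) where

  lookup-insert : lookup (insert π p v) p ≡ v
  lookup-insert = insertAt-lookup (Vec.map (punchIn v) π) p v

  lookup-insert-punchIn : ∀ i → lookup (insert π p v) (punchIn p i) ≡ punchIn v (lookup π i)
  lookup-insert-punchIn i = trans (insertAt-punchIn (Vec.map (punchIn v) π) p v i) (lookup-map i (punchIn v) π)

  insert-isPerm : IsPerm π → IsPerm (insert π p v)
  insert-isPerm π-perm i j eq with ≡⊎punchIn p i | ≡⊎punchIn p j
  ... | inj₁ refl | inj₁ refl = refl
  ... | inj₁ refl | inj₂ (j′ , refl) =
    contradiction (trans (sym (lookup-insert-punchIn j′)) (trans (sym eq) lookup-insert)) (punchInᵢ≢i v _)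
  ... | inj₂ (i′ , refl) | inj₁ refl =
    contradiction (trans (sym (lookup-insert-punchIn i′)) (trans eq lookup-insert)) (punchInᵢ≢i v _)
  ... | inj₂ (i′ , refl) | inj₂ (j′ , refl) = cong (punchIn p) (π-perm i′ j′ (punchIn-injective v _ _
    (trans (sym (lookup-insert-punchIn i′)) (trans eq (lookup-insert-punchIn j′)))))

  insert-isPerm⁻ : IsPerm (insert π p v) → IsPerm π
  insert-isPerm⁻ perm i j eq = punchIn-injective p i j (perm _ _
    (trans (lookup-insert-punchIn i) (trans (cong (punchIn v) eq) (sym (lookup-insert-punchIn j)))))

  insert-!-punchIn : ∀ i → insert π p v ! punchIn p i ≡ toℕ (punchIn v (lookup π i))
  insert-!-punchIn i = cong toℕ (lookup-insert-punchIn i)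

  ascent-insert : ∀ {i j} → Ascent π i j → Ascent (insert π p v) (punchIn p i) (punchIn p j)
  ascent-insert (i<j , πi<πj) =
    punchIn-mono-< p i<j , subst₂ _<_ (sym (insert-!-punchIn _)) (sym (insert-!-punchIn _)) (punchIn-mono-< v πi<πj)

  ascent-insert⁻ : ∀ {i j} → Ascent (insert π p v) (punchIn p i) (punchIn p j) → Ascent π i j
  ascent-insert⁻ (i<j , τi<τj) =
    punchIn-cancel-< p i<j , punchIn-cancel-< v (subst₂ _<_ (insert-!-punchIn _) (insert-!-punchIn _) τi<τj)

  avoids123-insert⁻ : Avoids123 (insert π p v) → Avoids123 π
  avoids123-insert⁻ avoids i j k ij jk = avoids _ _ _ (ascent-insert ij) (ascent-insert jk)

insert-injective : ∀ {n} {π π′ : Vec (Fin n) n} p {v v′} → insert π p v ≡ insert π′ p v′ → π ≡ π′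
insert-injective {π = π} {π′} p {v} {v′} eq with trans (sym (lookup-insert π p v)) (trans (cong (λ τ → lookup τ p) eq) (lookup-insert π′ p v′))
... | refl = lookup-ext λ i → punchIn-injective v _ _
  (trans (sym (lookup-insert-punchIn π p v i)) (trans (cong (λ τ → lookup τ (punchIn p i)) eq) (lookup-insert-punchIn π′ p v i)))

module _ {n} (τ : Vec (Fin (suc n)) (suc n)) (τ-perm : IsPerm τ) (p : Fin (suc n)) where

  private
    apart : ∀ i → lookup τ p ≢ lookup τ (punchIn p i)
    apart i eq = punchInᵢ≢i p i (sym (τ-perm p (punchIn p i) eq))

  remove : Vec (Fin n) n
  remove = tabulate λ i → punchOut (apart i)

  insert-remove : insert remove p (lookup τ p) ≡ τ
  insert-remove = lookup-ext λ i → case ≡⊎punchIn p i of λ where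
    (inj₁ refl)       → lookup-insert remove p (lookup τ p)
    (inj₂ (j , refl)) → trans (lookup-insert-punchIn remove p (lookup τ p) j)
                              (trans (cong (punchIn (lookup τ p)) (lookup∘tabulate (λ i → punchOut (apart i)) j))
                                     (punchIn-punchOut (apart j)))

prepend : ∀ {n} → Vec (Fin n) n → Fin (suc n) → Vec (Fin (suc n)) (suc n)
prepend σ v = insert σ 0F v

prepend-!-suc : ∀ {n} (σ : Vec (Fin n) n) v i → prepend σ v ! suc i ≡ toℕ (punchIn v (lookup σ i))
prepend-!-suc σ v = insert-!-punchIn σ 0F v

avoids123-prepend : ∀ {n} {σ : Vec (Fin n) n} {v} → Avoids123 σ → AscentsBelow σ (toℕ v) → Avoids123 (prepend σ v)
avoids123-prepend _ _ _ 0F _ (() , _) _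
avoids123-prepend _ _ _ (suc j) 0F _ (() , _)
avoids123-prepend {σ = σ} {v} _ below 0F (suc j) (suc k) (_ , v<τj) jk = <-asym v<τj τj<v
  where
  σj<v : σ ! j < toℕ v
  σj<v = below j k (ascent-insert⁻ σ 0F v jk)
  τj<v : prepend σ v ! suc j < toℕ v
  τj<v = subst (_< toℕ v) (sym (trans (prepend-!-suc σ v j) (toℕ-punchIn-< v σj<v))) σj<v
avoids123-prepend {σ = σ} {v} avoids _ (suc i) (suc j) (suc k) ij jk =
  avoids i j k (ascent-insert⁻ σ 0F v ij) (ascent-insert⁻ σ 0F v jk)

avoids123-prepend⁻ : ∀ {n} {σ : Vec (Fin n) n} {v} → Avoids123 (prepend σ v) → AscentsBelow σ (toℕ v)
avoids123-prepend⁻ {σ = σ} {v} avoids i j σij with σ ! i <? toℕ v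
... | yes σi<v = σi<v
... | no  σi≮v = ⊥-elim (avoids 0F (suc i) (suc j) (z<s , v<τi) (ascent-insert σ 0F v σij))
  where
  v<τi : toℕ v < prepend σ v ! suc i
  v<τi = subst (toℕ v <_) (sym (trans (prepend-!-suc σ v i) (toℕ-punchIn-≥ v (≮⇒≥ σi≮v)))) (s≤s (≮⇒≥ σi≮v))

prepend-splitAt-suc⁻ : ∀ {n} {σ : Vec (Fin n) n} {v j} → SkewSplitAt (prepend σ v) (suc j) → SkewSplitAt σ j × n ∸ j ≤ toℕ v
prepend-splitAt-suc⁻ {n} {σ} {v} {j} (block , rest) = (block′ , rest′) , v-in-block
  where
  v-in-block : n ∸ j ≤ toℕ v
  v-in-block = block 0F z<s
  block′ : ∀ i → toℕ i < j → n ∸ j ≤ σ ! i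
  block′ i i<j with σ ! i <? toℕ v
  ... | yes σi<v = subst (n ∸ j ≤_) (trans (prepend-!-suc σ v i) (toℕ-punchIn-< v σi<v)) (block (suc i) (s<s i<j))
  ... | no  σi≮v = ≤-trans v-in-block (≮⇒≥ σi≮v)
  rest′ : ∀ i → j ≤ toℕ i → σ ! i < n ∸ j
  rest′ i j≤i = ≤-<-trans (toℕ≤toℕ-punchIn v (lookup σ i)) (subst (_< n ∸ j) (prepend-!-suc σ v i) (rest (suc i) (s≤s j≤i)))

prepend-splitAt-suc : ∀ {n} {σ : Vec (Fin n) n} {v j} → SkewSplitAt σ j → n ∸ j ≤ toℕ v → SkewSplitAt (prepend σ v) (suc j)
prepend-splitAt-suc {n} {σ} {v} {j} (block , rest) v-in-block = block′ , rest′
  where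
  block′ : ∀ i → toℕ i < suc j → n ∸ j ≤ prepend σ v ! i
  block′ 0F      _         = v-in-block
  block′ (suc i) (s<s i<j) = ≤-trans (block i i<j) (subst (σ ! i ≤_) (sym (prepend-!-suc σ v i)) (toℕ≤toℕ-punchIn v (lookup σ i)))
  rest′ : ∀ i → suc j ≤ toℕ i → prepend σ v ! i < n ∸ j
  rest′ (suc i) (s≤s j≤i) = subst (_< n ∸ j) (sym (trans (prepend-!-suc σ v i) (toℕ-punchIn-< v σi<v))) (rest i j≤i)
    where
    σi<v : σ ! i < toℕ v
    σi<v = <-≤-trans (rest i j≤i) v-in-block

¬hasSkewSplit-prepend : ∀ {n} {σ : Vec (Fin n) n} {v} → ¬ HasSkewSplit σ → toℕ v < n → ¬ HasSkewSplit (prepend σ v)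
¬hasSkewSplit-prepend σ-indec v<n (suc J , _ , split) with J | prepend-splitAt-suc⁻ split
... | 0F     | _ , n≤v     = <⇒≱ v<n n≤v
... | suc J′ | σ-split , _ = σ-indec (suc J′ , z<s , σ-split)

¬hasSkewSplit-prepend⇒<block : ∀ {n} {σ : Vec (Fin n) n} {v} → ¬ HasSkewSplit (prepend σ v) →
                      ∀ J → SkewSplitAt σ (toℕ J) → toℕ v < n ∸ toℕ J
¬hasSkewSplit-prepend⇒<block {n} {σ} {v} τ-indec J split with toℕ v <? n ∸ toℕ J
... | yes v<block = v<block
... | no  v≮block = contradiction (suc J , z<s , prepend-splitAt-suc split (≮⇒≥ v≮block)) τ-indec

¬hasSkewSplit-prepend⇒<max : ∀ {n} {σ : Vec (Fin (suc n)) (suc n)} {v} → ¬ HasSkewSplit (prepend σ v) → toℕ v < suc n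
¬hasSkewSplit-prepend⇒<max {σ = σ} τ-indec = ¬hasSkewSplit-prepend⇒<block τ-indec 0F (skewSplitAt-0 σ)

-- Prepending v ≤ σ₀ creates the ascent v σ₀, which must not extend further.
prepend≤first⇒first≡max : ∀ {m} {σ : Vec (Fin (suc m)) (suc m)} {v} → IsPerm σ → Avoids123 (prepend σ v) →
                          toℕ v ≤ σ ! 0F → σ ! 0F ≡ m
prepend≤first⇒first≡max {σ = σ} {v} σ-perm avoids v≤σ0 with isPerm⇒attains-max σ σ-perm
... | 0F    , σ0≡m = σ0≡m
... | suc i , σi≡m = ⊥-elim (avoids 0F 1F (suc (suc i)) (z<s , v<τ1) (ascent-insert σ 0F v σ0σi))
  where
  v<τ1 : toℕ v < prepend σ v ! 1F
  v<τ1 = subst (toℕ v <_) (sym (trans (prepend-!-suc σ v 0F) (toℕ-punchIn-≥ v v≤σ0))) (s≤s v≤σ0)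
  σ0σi : Ascent σ 0F (suc i)
  σ0σi = z<s , subst (_ <_) (sym σi≡m) (below-max σ σ-perm σi≡m λ ())

hasSkewSplit⇒prepend-second≡max : ∀ {m} {σ : Vec (Fin (suc m)) (suc m)} {v} → IsPerm σ → Avoids123 (prepend σ v) →
                           ¬ HasSkewSplit (prepend σ v) → HasSkewSplit σ → prepend σ v ! 1F ≡ suc m
hasSkewSplit⇒prepend-second≡max {m} {σ} {v} σ-perm avoids τ-indec (J , 0<J , split) =
  trans (prepend-!-suc σ v 0F) (trans (toℕ-punchIn-≥ v v≤σ0) (cong suc σ0≡m))
  where
  v≤σ0 : toℕ v ≤ σ ! 0F
  v≤σ0 = <⇒≤ (<-≤-trans (¬hasSkewSplit-prepend⇒<block τ-indec J split) (proj₁ split 0F 0<J))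
  σ0≡m : σ ! 0F ≡ m
  σ0≡m = prepend≤first⇒first≡max σ-perm avoids v≤σ0

indec123-prepend : ∀ {n} {σ : Vec (Fin (suc (suc n))) (suc (suc n))} {v} →
                   Indec123 σ → σ ! 0F < toℕ v → toℕ v < suc (suc n) → Indec123 (prepend σ v)
indec123-prepend {σ = σ} {v} (perm , avoids , indec) σ0<v v<max =
  insert-isPerm σ 0F v perm , avoids123-prepend avoids (first<⇒ascentsBelow {π = σ} avoids σ0<v) , ¬hasSkewSplit-prepend indec v<max

indec123-prepend⁻ : ∀ {m} {σ : Vec (Fin (suc m)) (suc m)} {v} →
                    Indec123 (prepend σ v) → prepend σ v ! 1F ≢ suc m → Indec123 σ
indec123-prepend⁻ {σ = σ} {v} (perm , avoids , indec) τ1≢max =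
  σ-perm , avoids123-insert⁻ σ 0F v avoids , λ split → τ1≢max (hasSkewSplit⇒prepend-second≡max σ-perm avoids indec split)
  where
  σ-perm : IsPerm σ
  σ-perm = insert-isPerm⁻ σ 0F v perm

insertMax : ∀ {n} → Vec (Fin (suc n)) (suc n) → Vec (Fin (suc (suc n))) (suc (suc n))
insertMax {n} π = insert π 1F (fromℕ (suc n))

module _ {n} (π : Vec (Fin (suc n)) (suc n)) where

  insertMax-!-punchIn : ∀ i → insertMax π ! punchIn 1F i ≡ π ! i
  insertMax-!-punchIn i = trans (insert-!-punchIn π 1F _ i)
    (toℕ-punchIn-< (fromℕ (suc n)) (subst (π ! i <_) (sym (toℕ-fromℕ (suc n))) (toℕ<n (lookup π i))))

  insertMax-!-1 : insertMax π ! 1F ≡ suc n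
  insertMax-!-1 = trans (cong toℕ (lookup-insert π 1F _)) (toℕ-fromℕ (suc n))

  ¬ascent-from-second : ∀ k → ¬ Ascent (insertMax π) 1F k
  ¬ascent-from-second k (_ , τ1<τk) =
    <-irrefl refl (<-≤-trans (subst (_< insertMax π ! k) insertMax-!-1 τ1<τk) (≤-pred (toℕ<n (lookup (insertMax π) k))))

  avoids123-insertMax : Avoids123 π → Avoids123 (insertMax π)
  avoids123-insertMax avoids i j k ij jk with ≡⊎punchIn 1F i | ≡⊎punchIn 1F j | ≡⊎punchIn 1F k
  ... | inj₁ refl | _         | _         = ¬ascent-from-second j ij
  ... | _         | inj₁ refl | _         = ¬ascent-from-second k jk
  ... | _         | _         | inj₁ refl = n≮0 (<-≤-trans (proj₁ ij) (≤-pred (proj₁ jk)))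
  ... | inj₂ (x , refl) | inj₂ (y , refl) | inj₂ (z , refl) =
    avoids x y z (ascent-insert⁻ π 1F _ ij) (ascent-insert⁻ π 1F _ jk)

  ¬insertMax-splitAt-1 : ¬ SkewSplitAt (insertMax π) 1
  ¬insertMax-splitAt-1 (block , _) =
    <⇒≱ (subst (_< suc n) (sym (insertMax-!-punchIn 0F)) (toℕ<n (lookup π 0F))) (block 0F z<s)

  insertMax-splitAt⁻ : ∀ {j} → SkewSplitAt (insertMax π) (suc (suc j)) → SkewSplitAt π (suc j)
  insertMax-splitAt⁻ {j} (block , rest) = block′ , rest′
    where
    block′ : ∀ i → toℕ i < suc j → n ∸ j ≤ π ! i
    block′ 0F      _         = subst (n ∸ j ≤_) (insertMax-!-punchIn 0F) (block 0F z<s)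
    block′ (suc i) (s<s i<j) = subst (n ∸ j ≤_) (insertMax-!-punchIn (suc i)) (block (suc (suc i)) (s<s (s<s i<j)))
    rest′ : ∀ i → suc j ≤ toℕ i → π ! i < n ∸ j
    rest′ (suc i) (s≤s j≤i) = subst (_< n ∸ j) (insertMax-!-punchIn (suc i)) (rest (suc (suc i)) (s≤s (s≤s j≤i)))

  insertMax-splitAt : ∀ {j} → SkewSplitAt π (suc j) → SkewSplitAt (insertMax π) (suc (suc j))
  insertMax-splitAt {j} (block , rest) = block′ , rest′
    where
    block′ : ∀ i → toℕ i < suc (suc j) → n ∸ j ≤ insertMax π ! i
    block′ 0F            _               = subst (n ∸ j ≤_) (sym (insertMax-!-punchIn 0F)) (block 0F z<s)
    block′ 1F            _               = subst (n ∸ j ≤_) (sym insertMax-!-1) (≤-trans (m∸n≤m n j) (n≤1+n n))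
    block′ (suc (suc i)) (s<s (s<s i<j)) = subst (n ∸ j ≤_) (sym (insertMax-!-punchIn (suc i))) (block (suc i) (s<s i<j))
    rest′ : ∀ i → suc (suc j) ≤ toℕ i → insertMax π ! i < n ∸ j
    rest′ (suc (suc i)) (s≤s (s≤s j≤i)) = subst (_< n ∸ j) (sym (insertMax-!-punchIn (suc i))) (rest (suc i) (s≤s j≤i))

  hasSkewSplit-insertMax⁻ : HasSkewSplit (insertMax π) → HasSkewSplit π
  hasSkewSplit-insertMax⁻ (1F          , _ , split) = ⊥-elim (¬insertMax-splitAt-1 split)
  hasSkewSplit-insertMax⁻ (suc (suc J) , _ , split) = suc J , z<s , insertMax-splitAt⁻ split

  hasSkewSplit-insertMax : HasSkewSplit π → HasSkewSplit (insertMax π)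
  hasSkewSplit-insertMax (suc J , _ , split) = suc (suc J) , z<s , insertMax-splitAt split

  indec123-insertMax : Indec123 π → Indec123 (insertMax π)
  indec123-insertMax (perm , avoids , indec) =
    insert-isPerm π 1F _ perm , avoids123-insertMax avoids , indec ∘ hasSkewSplit-insertMax⁻

  indec123-insertMax⁻ : Indec123 (insertMax π) → Indec123 π
  indec123-insertMax⁻ (perm , avoids , indec) =
    insert-isPerm⁻ π 1F _ perm , avoids123-insert⁻ π 1F _ avoids , indec ∘ hasSkewSplit-insertMax

second≡max⇒insertMax-remove : ∀ {n} (τ : Vec (Fin (suc (suc n))) (suc (suc n))) (τ-perm : IsPerm τ) →
                       τ ! 1F ≡ suc n → insertMax (remove τ τ-perm 1F) ≡ τ
second≡max⇒insertMax-remove {n} τ τ-perm τ1≡max =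
  trans (cong (insert (remove τ τ-perm 1F) 1F) (toℕ-injective (trans (toℕ-fromℕ (suc n)) (sym τ1≡max))))
        (insert-remove τ τ-perm 1F)

insertMax≢prepend : ∀ {n} {π σ : Vec (Fin (suc n)) (suc n)} {v} → σ ! 0F < toℕ v → insertMax π ≢ prepend σ v
insertMax≢prepend {n} {π} {σ} {v} σ0<v eq = <-irrefl (sym max≡σ0) (toℕ<n (lookup σ 0F))
  where
  max≡σ0 : suc n ≡ σ ! 0F
  max≡σ0 = trans (sym (insertMax-!-1 π)) (trans (cong (_! 1F) eq) (trans (prepend-!-suc σ v 0F) (toℕ-punchIn-< v σ0<v)))

-- The generating tree

unique-concatMap : ∀ {A B : Set} (f : A → List B) {xs} → Unique xs → (∀ x → Unique (f x)) →
                   (∀ {x y z} → z ∈ f x → z ∈ f y → x ≡ y) → Unique (concatMap f xs)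
unique-concatMap f {[]}     _              _  _     = []
unique-concatMap f {x ∷ xs} (x∉xs ∷ xs-unique) f-unique apart =
  ++⁺ (f-unique x) (unique-concatMap f xs-unique f-unique apart) λ (z∈fx , z∈rest) →
    let y , y∈xs , z∈fy = find (∈-concatMap⁻ f z∈rest) in All.lookup x∉xs y∈xs (apart z∈fx z∈fy)

sum-map-concatMap : ∀ {A B : Set} (w : B → ℕ) (f : A → List B) xs →
                    sum (map w (concatMap f xs)) ≡ sum (map (sum ∘ map w ∘ f) xs)
sum-map-concatMap w f []       = refl
sum-map-concatMap w f (x ∷ xs) = trans (cong sum (map-++ w (f x) (concatMap f xs)))
  (trans (sum-++ (map w (f x)) _) (cong (sum (map w (f x)) +_) (sum-map-concatMap w f xs)))

sum-map-1≡length : ∀ {A : Set} (xs : List A) → sum (map (λ _ → 1) xs) ≡ length xs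
sum-map-1≡length []       = refl
sum-map-1≡length (x ∷ xs) = cong suc (sum-map-1≡length xs)

applyDownFrom-cong : ∀ {A : Set} {f g : ℕ → A} n → (∀ {i} → i < n → f i ≡ g i) → applyDownFrom f n ≡ applyDownFrom g n
applyDownFrom-cong zero    _   = refl
applyDownFrom-cong (suc n) f≡g = cong₂ _∷_ (f≡g ≤-refl) (applyDownFrom-cong n (f≡g ∘ m<n⇒m<1+n))

label : ∀ {n} → Vec (Fin (suc (suc n))) (suc (suc n)) → ℕ
label {n} π = suc n ∸ π ! 0F

belowTop : ∀ N → ℕ → Fin (suc N)
belowTop N i = fromℕ< (s≤s (m∸n≤m N (suc i)))

toℕ-belowTop : ∀ N i → toℕ (belowTop N i) ≡ N ∸ suc i
toℕ-belowTop N i = toℕ-fromℕ< (s≤s (m∸n≤m N (suc i)))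

children : ∀ {n} → Vec (Fin (suc (suc n))) (suc (suc n)) → List (Vec (Fin (suc (suc (suc n)))) (suc (suc (suc n))))
children {n} π = insertMax π ∷ applyDownFrom (prepend π ∘ belowTop (suc (suc n))) (label π)

module _ {n} (π : Vec (Fin (suc (suc n))) (suc (suc n))) where

  label-insertMax : label (insertMax π) ≡ suc (label π)
  label-insertMax = trans (cong (suc (suc n) ∸_) (insertMax-!-punchIn π 0F)) (+-∸-assoc 1 (≤-pred (toℕ<n (lookup π 0F))))

  label-prepend : ∀ {i} → i < label π → label (prepend π (belowTop (suc (suc n)) i)) ≡ suc i
  label-prepend {i} i<c = trans (cong (suc (suc n) ∸_) (toℕ-belowTop (suc (suc n)) i))
                                (m∸[m∸n]≡n (s≤s (<⇒≤ (<-≤-trans i<c (m∸n≤m (suc n) (π ! 0F))))))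

  first<belowTop : ∀ {i} → i < label π → π ! 0F < toℕ (belowTop (suc (suc n)) i)
  first<belowTop {i} i<c = subst (_< toℕ (belowTop (suc (suc n)) i))
    (m∸[m∸n]≡n (≤-pred (toℕ<n (lookup π 0F))))
    (subst (suc n ∸ label π <_) (sym (toℕ-belowTop (suc (suc n)) i)) (∸-monoʳ-< i<c (m∸n≤m (suc n) (π ! 0F))))

  belowTop<max : ∀ i → toℕ (belowTop (suc (suc n)) i) < suc (suc n)
  belowTop<max i = subst (_< suc (suc n)) (sym (toℕ-belowTop (suc (suc n)) i)) (s≤s (m∸n≤m (suc n) i))

  ∈-prepends⁻ : ∀ {τ} → τ ∈ applyDownFrom (prepend π ∘ belowTop (suc (suc n))) (label π) →
                ∃ λ v → π ! 0F < toℕ v × toℕ v < suc (suc n) × τ ≡ prepend π v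
  ∈-prepends⁻ τ∈ with ∈-applyDownFrom⁻ (prepend π ∘ belowTop (suc (suc n))) τ∈
  ... | i , i<c , τ≡ = belowTop (suc (suc n)) i , first<belowTop i<c , belowTop<max i , τ≡

  children-weight : ∀ k → sum (map (λ τ → ballot k (label τ)) (children π)) ≡ ballot (suc k) (label π)
  children-weight k = begin
    ballot k (label (insertMax π)) + sum (map (λ τ → ballot k (label τ)) (applyDownFrom child (label π)))
      ≡⟨ cong₂ _+_ (cong (ballot k) label-insertMax) (cong sum (map-applyDownFrom child (λ τ → ballot k (label τ)) (label π))) ⟩
    ballot k (suc (label π)) + sum (applyDownFrom (λ i → ballot k (label (child i))) (label π))
      ≡⟨ cong (λ l → ballot k (suc (label π)) + sum l) (applyDownFrom-cong (label π) (cong (ballot k) ∘ label-prepend)) ⟩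
    ballot k (suc (label π)) + sum (applyDownFrom (ballot k ∘ suc) (label π))
      ≡⟨ sym (ballot-suc k (label π)) ⟩
    ballot (suc k) (label π) ∎
    where
    child : ℕ → Vec (Fin (suc (suc (suc n)))) (suc (suc (suc n)))
    child = prepend π ∘ belowTop (suc (suc n))

children-sound : ∀ {n} {π : Vec (Fin (suc (suc n))) (suc (suc n))} {τ} → Indec123 π → τ ∈ children π → Indec123 τ
children-sound {π = π} π-indec (here refl) = indec123-insertMax π π-indec
children-sound {π = π} π-indec (there τ∈) with ∈-prepends⁻ π τ∈
... | v , π0<v , v<max , refl = indec123-prepend π-indec π0<v v<max

prepend∈children : ∀ {n} {σ : Vec (Fin (suc (suc n))) (suc (suc n))} {v} →
                   Indec123 σ → Indec123 (prepend σ v) → prepend σ v ∈ children σ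
prepend∈children {n} {σ} {v} σ-indec τ-indec@(_ , τ-avoids , τ-indec′) =
  there (subst (λ w → prepend σ w ∈ _) belowTop≡v (∈-applyDownFrom⁺ (prepend σ ∘ belowTop (suc (suc n))) i<c))
  where
  i : ℕ
  i = suc n ∸ toℕ v
  v≤max : toℕ v ≤ suc n
  v≤max = ≤-pred (¬hasSkewSplit-prepend⇒<max {σ = σ} τ-indec′)
  i<c : i < label σ
  i<c = ∸-monoʳ-< (ascentsBelow⇒first< {π = σ} σ-indec (avoids123-prepend⁻ {σ = σ} τ-avoids)) v≤max
  belowTop≡v : belowTop (suc (suc n)) i ≡ v
  belowTop≡v = toℕ-injective (trans (toℕ-belowTop (suc (suc n)) i) (m∸[m∸n]≡n v≤max))

children-complete : ∀ {n} (τ : Vec (Fin (suc (suc (suc n)))) (suc (suc (suc n)))) → Indec123 τ →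
                    ∃ λ π → Indec123 π × τ ∈ children π
children-complete {n} τ τ-indec@(τ-perm , _) with τ ! 1F ℕ.≟ suc (suc n)
... | yes τ1≡max = π , indec123-insertMax⁻ π (subst Indec123 (sym τ≡) τ-indec) , here (sym τ≡)
  where
  π : Vec (Fin (suc (suc n))) (suc (suc n))
  π = remove τ τ-perm 1F
  τ≡ : insertMax π ≡ τ
  τ≡ = second≡max⇒insertMax-remove τ τ-perm τ1≡max
... | no τ1≢max = σ , σ-indec , subst (_∈ children σ) τ≡ (prepend∈children σ-indec τ-indec′)
  where
  σ : Vec (Fin (suc (suc n))) (suc (suc n))
  σ = remove τ τ-perm 0F
  τ≡ : prepend σ (lookup τ 0F) ≡ τ
  τ≡ = insert-remove τ τ-perm 0F
  τ-indec′ : Indec123 (prepend σ (lookup τ 0F))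
  τ-indec′ = subst Indec123 (sym τ≡) τ-indec
  σ-indec : Indec123 σ
  σ-indec = indec123-prepend⁻ τ-indec′ (τ1≢max ∘ subst (λ ρ → ρ ! 1F ≡ suc (suc n)) τ≡)

children-unique : ∀ {n} (π : Vec (Fin (suc (suc n))) (suc (suc n))) → Unique (children π)
children-unique {n} π = All.tabulate insertMax∉ ∷ applyDownFrom⁺₁ _ (label π) distinct
  where
  N : ℕ
  N = suc (suc n)
  insertMax∉ : ∀ {τ} → τ ∈ applyDownFrom (prepend π ∘ belowTop N) (label π) → insertMax π ≢ τ
  insertMax∉ τ∈ with ∈-prepends⁻ π τ∈
  ... | _ , π0<v , _ , refl = insertMax≢prepend π0<v
  distinct : ∀ {i j} → j < i → i < label π → prepend π (belowTop N i) ≢ prepend π (belowTop N j)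
  distinct {i} {j} j<i i<c eq = <-irrefl (sym (suc-injective i≡j)) j<i
    where
    i≡j : suc i ≡ suc j
    i≡j = ∸-cancelˡ-≡ (s≤s (<⇒≤ (<-≤-trans i<c (m∸n≤m (suc n) (π ! 0F)))))
                      (s≤s (<⇒≤ (<-trans j<i (<-≤-trans i<c (m∸n≤m (suc n) (π ! 0F))))))
                      (trans (sym (toℕ-belowTop N i)) (trans (cong (λ τ → toℕ (lookup τ 0F)) eq) (toℕ-belowTop N j)))

children-disjoint : ∀ {n} {π π′ : Vec (Fin (suc (suc n))) (suc (suc n))} {τ} → τ ∈ children π → τ ∈ children π′ → π ≡ π′
children-disjoint (here refl) (here eq) = insert-injective 1F eq
children-disjoint {π′ = π′} (here refl) (there τ∈′) with ∈-prepends⁻ π′ τ∈′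
... | _ , π′0<v , _ , eq = ⊥-elim (insertMax≢prepend π′0<v eq)
children-disjoint {π = π} (there τ∈) (here refl) with ∈-prepends⁻ π τ∈
... | _ , π0<v , _ , eq = ⊥-elim (insertMax≢prepend π0<v eq)
children-disjoint {π = π} {π′} (there τ∈) (there τ∈′) with ∈-prepends⁻ π τ∈ | ∈-prepends⁻ π′ τ∈′
... | _ , _ , _ , eq | _ , _ , _ , eq′ = insert-injective 0F (trans (sym eq) eq′)

level : ∀ n → List (Vec (Fin (suc (suc n))) (suc (suc n)))
level zero    = insertMax (0F ∷ []) ∷ []
level (suc n) = concatMap children (level n)

level-sound : ∀ n {τ} → τ ∈ level n → Indec123 τ
level-sound zero    (here refl) = indec123-insertMax (0F ∷ []) indec123-singleton
level-sound (suc n) τ∈ with find (∈-concatMap⁻ children τ∈)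
... | π , π∈ , τ∈π = children-sound (level-sound n π∈) τ∈π

level-complete : ∀ n (τ : Vec (Fin (suc (suc n))) (suc (suc n))) → Indec123 τ → τ ∈ level n
level-complete zero τ (τ-perm , _ , τ-indec) with isPerm⇒attains-max τ τ-perm
... | 0F , τ0≡max = contradiction (first-max⇒hasSkewSplit τ τ-perm τ0≡max) τ-indec
... | 1F , τ1≡max =
  here (trans (sym (second≡max⇒insertMax-remove τ τ-perm τ1≡max)) (cong insertMax (unique-singleton (remove τ τ-perm 1F))))
level-complete (suc n) τ τ-indec with children-complete τ τ-indec
... | π , π-indec , τ∈ = ∈-concatMap⁺ children (lose (level-complete n π π-indec) τ∈)

level-unique : ∀ n → Unique (level n)
level-unique zero    = All.[] ∷ []
level-unique (suc n) = unique-concatMap children (level-unique n) children-unique children-disjoint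

level-weight : ∀ n k → sum (map (λ τ → ballot k (label τ)) (level n)) ≡ ballot (k + n) 1
level-weight zero    k = trans (+-identityʳ (ballot k 1)) (cong (λ j → ballot j 1) (sym (+-identityʳ k)))
level-weight (suc n) k = begin
  sum (map (λ τ → ballot k (label τ)) (concatMap children (level n)))
    ≡⟨ sum-map-concatMap _ children (level n) ⟩
  sum (map (λ π → sum (map (λ τ → ballot k (label τ)) (children π))) (level n))
    ≡⟨ cong sum (map-cong (λ π → children-weight π k) (level n)) ⟩
  sum (map (λ π → ballot (suc k) (label π)) (level n))
    ≡⟨ level-weight n (suc k) ⟩
  ballot (suc k + n) 1
    ≡⟨ cong (λ j → ballot j 1) (sym (+-suc k n)) ⟩
  ballot (k + suc n) 1 ∎

level-length : ∀ n → length (level n) ≡ catalan (suc n)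
level-length n = trans (sym (sum-map-1≡length (level n))) (trans (level-weight n 0) (sym (catalan≡ballot n)))

proposition2p5 : (m : ℕ) →
    HasCount {Vec (Fin (suc m)) (suc m)}
      (λ π → IsPerm π × Avoids π p123 × SkewIndecomposable π)
      (catalan m)
proposition2p5 zero =
  (0F ∷ []) ∷ [] , All.[] ∷ [] ,
  (λ π → (λ { (here refl) → indec123⇒skewIndecomposable-avoider indec123-singleton }) , λ _ → here (unique-singleton π)) ,
  refl
proposition2p5 (suc n) =
  level n , level-unique n , (λ τ → indec123⇒skewIndecomposable-avoider ∘ level-sound n , level-complete n τ ∘ skewIndecomposable-avoider⇒indec123) , level-length n
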